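{- Let $f:\Pi\to\mathbb{R}$ be tropically polarized. Then its restriction $f_1$ to level one, $f_1(x,y)=f(x,y,1)$ for $x,y\in\{1,3,\dots,2n-1\}$, is supermodular, i.e. $f_1(x,y)-f_1(x-2,y)-f_1(x,y-2)+f_1(x-2,y-2)\ge 0$ for all $x,y\in\{3,5,\dots,2n-1\}$.
   Context: $\Pi$ is the set of integer points $(i,j,k)$ with $0\le k\le n$, $k\le i,j\le 2n-k$, and $i\equiv j\equiv k \pmod 2$. A center of an elementary octahedron is an integer point $(i,j,k)$ with $1\le k\le n-1$, $k+1\le i,j\le 2n-k-1$, $i\equiv j\equiv k+1\pmod 2$. A function $f:\Pi\to\mathbb{R}$ is tropically polarized if $f(i,j,0)=0$ for all $(i,j,0)\in\Pi$ and for every center $(i,j,k)$ of an elementary octahedron $$f(i-1,j-1,k)+f(i+1,j+1,k)=\max\bigl(f(i,j,k-1)+f(i,j,k+1),\ f(i-1,j+1,k)+f(i+1,j-1,k)\bigr).$$ -}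

module Defs where

open import Level using (0ℓ)
open import Data.Nat using (ℕ; zero; suc; _+_; _*_; _∸_; _≤_; _%_)
open import Data.Product using (_×_)
open import Data.Sum using (_⊎_)
open import Relation.Binary.PropositionalEquality using (_≡_)
open import Relation.Binary.Structures using (IsTotalOrder)
open import Algebra.Structures using (IsAbelianGroup)

-- The statement only
-- uses the additive group of ℝ, its total order and `max`, so we state it
-- for an arbitrary totally ordered abelian group (ℝ being an instance).
record OrderedAbelianGroup : Set₁ where
  infixl 6 _+ᴳ_ _-ᴳ_
  infix 4 _≤ᴳ_
  field
    Carrier        : Set
    _+ᴳ_           : Carrier → Carrier → Carrier
    0#             : Carrier
    -ᴳ_            : Carrier → Carrier
    isAbelianGroup : IsAbelianGroup _≡_ _+ᴳ_ 0# -ᴳ_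
    _≤ᴳ_           : Carrier → Carrier → Set
    isTotalOrder   : IsTotalOrder _≡_ _≤ᴳ_
    +-monoˡ        : ∀ {x y} z → x ≤ᴳ y → x +ᴳ z ≤ᴳ y +ᴳ z
    max            : Carrier → Carrier → Carrier
    max-upperˡ     : ∀ x y → x ≤ᴳ max x y
    max-upperʳ     : ∀ x y → y ≤ᴳ max x y
    max-sel        : ∀ x y → (max x y ≡ x) ⊎ (max x y ≡ y)

  _-ᴳ_ : Carrier → Carrier → Carrier
  x -ᴳ y = x +ᴳ (-ᴳ y)

InΠ : ℕ → ℕ → ℕ → ℕ → Set
InΠ n i j k =
  k ≤ n × k ≤ i × i + k ≤ 2 * n × k ≤ j × j + k ≤ 2 * n
  × i % 2 ≡ k % 2 × j % 2 ≡ k % 2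

Center : ℕ → ℕ → ℕ → ℕ → Set
Center n i j k =
  1 ≤ k × k + 1 ≤ n × k + 1 ≤ i × i + k + 1 ≤ 2 * n
  × k + 1 ≤ j × j + k + 1 ≤ 2 * n
  × i % 2 ≡ suc k % 2 × j % 2 ≡ suc k % 2

-- f : Π → G is modelled as a function ℕ → ℕ → ℕ → G; only its values on Π
-- are ever constrained or used.
TropicallyPolarized : (G : OrderedAbelianGroup) → ℕ →
  (ℕ → ℕ → ℕ → OrderedAbelianGroup.Carrier G) → Set
TropicallyPolarized G n f =
  (∀ i j → InΠ n i j 0 → f i j 0 ≡ 0#)
  × (∀ i j k → Center n i j k →
      f (i ∸ 1) (j ∸ 1) k +ᴳ f (suc i) (suc j) k
        ≡ max (f i j (k ∸ 1) +ᴳ f i j (suc k))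
              (f (i ∸ 1) (suc j) k +ᴳ f (suc i) (j ∸ 1) k))
  where open OrderedAbelianGroup G

{-# OPTIONS --safe #-}
-- The octahedron recurrence centred at (x-1, y-1, 1) writes the diagonal sum
-- f₁(x-2,y-2) + f₁(x,y) of a unit square at level one as a maximum, one of
-- whose arguments is the antidiagonal sum f₁(x-2,y) + f₁(x,y-2).  So the
-- diagonal sum dominates, which is supermodularity.
module Submission where

open import Defs
open import Level using (0ℓ)
open import Algebra.Bundles using (AbelianGroup)
import Algebra.Properties.AbelianGroup as AbelianGroupProperties
import Algebra.Solver.CommutativeMonoid as CommutativeMonoidSolver
open import Data.Fin using (zero; suc)
open import Data.Vec using ([]; _∷_)
open import Data.Nat using (ℕ; zero; suc; _+_; _*_; _∸_; _≤_; _<_; _%_; pred; NonZero; s≤s; s≤s⁻¹; z≤n)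
open import Data.Nat.Properties using (≤-trans; +-comm; +-assoc; *-cancelˡ-≤)
open import Data.Product using (_,_; proj₂)
open import Relation.Binary.PropositionalEquality using (_≡_; refl; sym; trans; cong; subst; module ≡-Reasoning)

module OrderedAbelianGroupProperties (G : OrderedAbelianGroup) where
  open OrderedAbelianGroup G

  abelianGroup : AbelianGroup 0ℓ 0ℓ
  abelianGroup = record { isAbelianGroup = isAbelianGroup }

  open AbelianGroup abelianGroup using (inverseʳ; commutativeMonoid)
  open AbelianGroupProperties abelianGroup using (⁻¹-∙-comm)
  open CommutativeMonoidSolver commutativeMonoid using (prove; var; _⊕_)
  open ≡-Reasoning

  x≤y⇒0≤y-x : ∀ {x y} → x ≤ᴳ y → 0# ≤ᴳ y -ᴳ x
  x≤y⇒0≤y-x {x} x≤y = subst (_≤ᴳ _) (inverseʳ x) (+-monoˡ (-ᴳ x) x≤y)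

  [a+b]-[c+d]≡b-c-d+a : ∀ a b c d → (a +ᴳ b) -ᴳ (c +ᴳ d) ≡ b -ᴳ c -ᴳ d +ᴳ a
  [a+b]-[c+d]≡b-c-d+a a b c d = begin
    (a +ᴳ b) +ᴳ -ᴳ (c +ᴳ d)      ≡⟨ cong (a +ᴳ b +ᴳ_) (sym (⁻¹-∙-comm c d)) ⟩
    (a +ᴳ b) +ᴳ (-ᴳ c +ᴳ -ᴳ d)   ≡⟨ prove 4 ((α ⊕ β) ⊕ (γ ⊕ δ)) (((β ⊕ γ) ⊕ δ) ⊕ α)
                                          (a ∷ b ∷ -ᴳ c ∷ -ᴳ d ∷ []) ⟩
    b -ᴳ c -ᴳ d +ᴳ a             ∎
    where
    α = var zero
    β = var (suc zero)
    γ = var (suc (suc zero))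
    δ = var (suc (suc (suc zero)))

m≤pred[n]⇒m<n : ∀ {m n} .{{_ : NonZero m}} → m ≤ pred n → m < n
m≤pred[n]⇒m<n {suc m} {zero} ()
m≤pred[n]⇒m<n {n = suc n} m≤n = s≤s m≤n

m%2≡1⇒[1+m]%2≡0 : ∀ m → m % 2 ≡ 1 → suc m % 2 ≡ 0
m%2≡1⇒[1+m]%2≡0 zero          ()
m%2≡1⇒[1+m]%2≡0 (suc zero)    _       = refl
m%2≡1⇒[1+m]%2≡0 (suc (suc m)) m-odd   = m%2≡1⇒[1+m]%2≡0 m m-odd

center-at-level-one : ∀ {n x y} →
  3 ≤ 2 + x → 2 + x ≤ 2 * n ∸ 1 → (2 + x) % 2 ≡ 1 →
  3 ≤ 2 + y → 2 + y ≤ 2 * n ∸ 1 → (2 + y) % 2 ≡ 1 →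
  Center n (1 + x) (1 + y) 1
center-at-level-one {n} {x} {y} 3≤x x≤2n-1 x-odd 3≤y y≤2n-1 y-odd =
  s≤s z≤n , 2≤n , s≤s⁻¹ 3≤x , within-upper-edge x x≤2n-1 , s≤s⁻¹ 3≤y , within-upper-edge y y≤2n-1
  , m%2≡1⇒[1+m]%2≡0 x x-odd , m%2≡1⇒[1+m]%2≡0 y y-odd
  where
  within-upper-edge : ∀ z → 2 + z ≤ 2 * n ∸ 1 → 1 + z + 1 + 1 ≤ 2 * n
  within-upper-edge z z≤2n-1 = subst (_≤ 2 * n) (cong suc (sym (trans (+-assoc z 1 1) (+-comm z 2))))
    (m≤pred[n]⇒m<n z≤2n-1)
  2≤n : 2 ≤ n
  2≤n = *-cancelˡ-≤ 2 (≤-trans (s≤s 3≤x) (m≤pred[n]⇒m<n x≤2n-1))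

module _ {G : OrderedAbelianGroup} {n : ℕ} {f : ℕ → ℕ → ℕ → OrderedAbelianGroup.Carrier G}
         (polarized : TropicallyPolarized G n f) where
  open OrderedAbelianGroup G

  antidiagonal≤diagonal : ∀ {i j k} → Center n i j k →
    f (i ∸ 1) (suc j) k +ᴳ f (suc i) (j ∸ 1) k ≤ᴳ f (i ∸ 1) (j ∸ 1) k +ᴳ f (suc i) (suc j) k
  antidiagonal≤diagonal {i} {j} {k} c =
    subst (_ ≤ᴳ_) (sym (proj₂ polarized i j k c)) (max-upperʳ _ _)

proposition1 : (G : OrderedAbelianGroup) (n : ℕ)
    (f : ℕ → ℕ → ℕ → OrderedAbelianGroup.Carrier G) →
    TropicallyPolarized G n f →
    (x y : ℕ) → 3 ≤ x → x ≤ 2 * n ∸ 1 → x % 2 ≡ 1 →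
    3 ≤ y → y ≤ 2 * n ∸ 1 → y % 2 ≡ 1 →
    let open OrderedAbelianGroup G in
    0# ≤ᴳ f x y 1 -ᴳ f (x ∸ 2) y 1 -ᴳ f x (y ∸ 2) 1 +ᴳ f (x ∸ 2) (y ∸ 2) 1
proposition1 G n f _ 0 _ () _ _ _ _ _
proposition1 G n f _ 1 _ (s≤s ()) _ _ _ _ _
proposition1 G n f _ (suc (suc x)) 0 _ _ _ () _ _
proposition1 G n f _ (suc (suc x)) 1 _ _ _ (s≤s ()) _ _
proposition1 G n f polarized (suc (suc x)) (suc (suc y)) 3≤x x≤2n-1 x-odd 3≤y y≤2n-1 y-odd =
  subst (0# ≤ᴳ_) ([a+b]-[c+d]≡b-c-d+a _ _ _ _) (x≤y⇒0≤y-x (antidiagonal≤diagonal {G} {f = f} polarized center))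
  where
  open OrderedAbelianGroup G
  open OrderedAbelianGroupProperties G
  center : Center n (suc x) (suc y) 1
  center = center-at-level-one 3≤x x≤2n-1 x-odd 3≤y y≤2n-1 y-odd
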